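{- Let $p\ge3$ be a prime and $\gamma\in p\mathbb{Z}_p$ with $2|\gamma|_p<1$. For any integer $m\ge2$, there is a positive integer $k\le\frac{1}{|\gamma|_p}\left(\frac{1}{|m|_p}+1\right)-2$ such that \[ \mathbb{Z}_p=\{x_1^m+x_2^m+\cdots+x_k^m:\ x_i\in\mathcal{C}_\gamma,\ 1\le i\le k\}. \]
   Context: $\mathbb{Z}_p$ is the ring of $p$-adic integers and $|\cdot|_p$ the $p$-adic absolute value. For $\gamma\in p\mathbb{Z}_p$ with $2|\gamma|_p<1$, $\mathcal{C}_\gamma=\left\{\sum_{n=0}^\infty a_n\gamma^n:\ a_n\in\{0,\gamma-1\}\right\}\subseteq\mathbb{Z}_p$. -}

module Defs where

open import Data.Nat using (ℕ; zero; suc; _+_; _*_; _∸_; _^_; _≤_; _<_; NonZero)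
open import Data.Nat.Properties using (m^n≢0)
open import Data.Nat.DivMod using (_%_)
open import Data.Bool using (Bool; true; false; if_then_else_)
open import Data.Fin using (Fin)
import Data.Fin as F
open import Data.Product using (Σ; ∃; _×_)
open import Relation.Binary.PropositionalEquality using (_≡_)

-- A p-adic integer is represented by its compatible system of residues:
-- x n ∈ {0,…,p^n - 1} is x mod p^n  (Z_p = lim Z/p^n Z).
Raw : Set
Raw = ℕ → ℕ

module _ (p : ℕ) .{{_ : NonZero p}} where

  modP : ℕ → ℕ → ℕ
  modP n a = _%_ a (p ^ n) {{m^n≢0 p n}}

  IsZp : Raw → Set
  IsZp x = (∀ n → x n < p ^ n) × (∀ n → modP n (x (suc n)) ≡ x n)

  Zp : Set
  Zp = Σ Raw IsZp

  zeroZ : Raw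
  zeroZ n = 0

  oneZ : Raw
  oneZ n = modP n 1

  minusOneZ : Raw
  minusOneZ n = p ^ n ∸ 1

  addZ : Raw → Raw → Raw
  addZ x y n = modP n (x n + y n)

  mulZ : Raw → Raw → Raw
  mulZ x y n = modP n (x n * y n)

  powZ : Raw → ℕ → Raw
  powZ x zero = oneZ
  powZ x (suc m) = mulZ x (powZ x m)

  sumPow : (k : ℕ) → (Fin k → Raw) → ℕ → Raw
  sumPow zero xs m = zeroZ
  sumPow (suc k) xs m = addZ (powZ (xs F.zero) m) (sumPow k (λ i → xs (F.suc i)) m)

  partialSum : Raw → (ℕ → Bool) → ℕ → Raw
  partialSum γ b zero = zeroZ
  partialSum γ b (suc N) =
    addZ (partialSum γ b N)
         (if b N then mulZ (addZ γ minusOneZ) (powZ γ N) else zeroZ)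

  -- x ∈ C_γ : x = Σ_{n≥0} a_n γ^n (p-adic limit of partial sums), a_n ∈ {0, γ-1}
  InCantor : Raw → Raw → Set
  InCantor γ x = ∃ λ (b : ℕ → Bool) → ∀ n → ∃ λ N₀ → ∀ N → N₀ ≤ N → x n ≡ partialSum γ b N n

  ValZp : Raw → ℕ → Set
  ValZp γ d = (γ d ≡ 0) × (γ (suc d) ≡ 0 → Data.Empty.⊥)
    where import Data.Empty

open import Data.Nat.Divisibility using (_∣_)
open import Relation.Nullary using (¬_)

ValNat : ℕ → ℕ → ℕ → Set
ValNat p m e = (p ^ e ∣ m) × ¬ (p ^ suc e ∣ m)

{-# OPTIONS --safe #-}
module Submission where

-- Let Q = p ^ d and write the summands as x_i = Σ_j b_ij (γ - 1) γ^j ∈ C_γ, i < k.  The digits are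
-- chosen by thresholds: b_i0 = 1 iff i < R, and b_ij = 1 iff f_j ≤ i < R.  Every x_i with i < R is
-- then ≡ -1 modulo p ^ d, and since the m-th power map is linear on small p-adic neighbourhoods
-- (up to an error governed by e = v_p(m)), switching on digit j in x_i changes x_i ^ m by
-- (-1)^(m-1) m (γ - 1) γ^j = w p^(e + j d) with w a unit, modulo p^(e + (j + 1) d).  Hence
-- after x ≡ Σ x_i ^ m modulo p^(e + j d) the next d digits of x are matched by solving
-- (R - f_j) w ≡ t modulo p ^ d, which has a solution 0 ≤ f_j < Q ≤ R + 1.  The start needs
-- R (-1)^m ≡ x modulo p^(e + d), i.e. R = Q - 1 + r with r < p^(e + d), so R ≤ k.  Thresholds
-- fixed stage by stage define the x_i, and the congruences at all levels give equality in ℤ_p.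

open import Data.Bool using (Bool; true; false; if_then_else_; _∧_; not)
open import Data.Empty using (⊥-elim)
open import Data.Fin using (Fin; toℕ)
open import Data.Integer using (ℤ; +_; -[1+_]; 0ℤ; 1ℤ; -1ℤ; ∣_∣)
import Data.Integer.DivMod as ℤD
import Data.Integer.Properties as ℤP
open import Data.Integer.Divisibility.Signed using (_∣_; divides; ∣⇒∣ᵤ; ∣ᵤ⇒∣)
open import Data.Integer.Tactic.RingSolver using (solve-∀)
import Data.Nat as ℕ
open ℕ using (ℕ; zero; suc; NonZero; z≤n; s≤s; _<ᵇ_)
import Data.Nat.DivMod as ℕD
import Data.Nat.Divisibility as ℕDv
import Data.Nat.Properties as ℕP
import Data.Nat.Tactic.RingSolver as ℕS
open import Data.Nat.Primality using (Prime; prime⇒irreducible; euclidsLemma; ¬prime[1])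
open import Data.Nat.Coprimality using (Coprime; coprime-Bézout)
open import Data.Nat.GCD using (module Bézout)
open import Data.Product using (∃; _×_; _,_; proj₁; proj₂)
open import Data.Sum using (_⊎_; inj₁; inj₂; [_,_]′)
open import Relation.Binary.Bundles using (Setoid)
open import Relation.Binary.PropositionalEquality
open import Relation.Nullary using (¬_; Dec; yes; no)
open import Defs

module IntegerPowers where
  open import Data.Integer using (_*_; _^_)

  ^-distribʳ-* : ∀ a b n → (a * b) ^ n ≡ a ^ n * b ^ n
  ^-distribʳ-* a b zero    = refl
  ^-distribʳ-* a b (suc n) = trans (cong (λ z → a * b * z) (^-distribʳ-* a b n)) (lemma a b (a ^ n) (b ^ n))
    where lemma : ∀ a b A B → a * b * (A * B) ≡ a * A * (b * B)
          lemma = solve-∀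

  pos-^ : ∀ a n → (+ a) ^ n ≡ + (a ℕ.^ n)
  pos-^ a zero    = refl
  pos-^ a (suc n) = trans (cong (λ z → + a * z) (pos-^ a n)) (sym (ℤP.pos-* a (a ℕ.^ n)))

open IntegerPowers

module Congruence (p : ℕ) where
  open import Data.Integer using (_+_; _*_; _-_; _^_; -_)

  infix 8 p^_
  p^_ : ℕ → ℤ
  p^ n = + (p ℕ.^ n)

  p^-+ : ∀ a b → p^ (a ℕ.+ b) ≡ p^ a * p^ b
  p^-+ a b = trans (cong +_ (ℕP.^-distribˡ-+-* p a b)) (ℤP.pos-* (p ℕ.^ a) (p ℕ.^ b))

  infix 4 _≋_[p^_]
  record _≋_[p^_] (a b : ℤ) (n : ℕ) : Set where
    constructor mod
    field divides-difference : p^ n ∣ a - b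

  ≋-intro : ∀ {a b n} t → a ≡ b + t * p^ n → a ≋ b [p^ n ]
  ≋-intro {b = b} {n = n} t refl = mod (divides t (lemma b t (p^ n)))
    where lemma : ∀ b t P → b + t * P - b ≡ t * P
          lemma = solve-∀

  ≋-elim : ∀ {a b n} → a ≋ b [p^ n ] → ∃ λ t → a ≡ b + t * p^ n
  ≋-elim {a} {b} (mod (divides t eq)) = t , trans (lemma a b) (cong (λ z → b + z) eq)
    where lemma : ∀ a b → a ≡ b + (a - b)
          lemma = solve-∀

  ≋-refl : ∀ {a n} → a ≋ a [p^ n ]
  ≋-refl {a} {n} = ≋-intro 0ℤ (lemma a (p^ n))
    where lemma : ∀ a P → a ≡ a + 0ℤ * P
          lemma = solve-∀

  ≋-reflexive : ∀ {a b n} → a ≡ b → a ≋ b [p^ n ]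
  ≋-reflexive refl = ≋-refl

  ≋-sym : ∀ {a b n} → a ≋ b [p^ n ] → b ≋ a [p^ n ]
  ≋-sym {b = b} {n = n} h with ≋-elim h
  ... | t , refl = ≋-intro (- t) (lemma b t (p^ n))
    where lemma : ∀ b t P → b ≡ b + t * P + (- t) * P
          lemma = solve-∀

  ≋-trans : ∀ {a b c n} → a ≋ b [p^ n ] → b ≋ c [p^ n ] → a ≋ c [p^ n ]
  ≋-trans {c = c} {n} h₁ h₂ with ≋-elim h₁ | ≋-elim h₂
  ... | t , refl | u , refl = ≋-intro (u + t) (lemma c t u (p^ n))
    where lemma : ∀ c t u P → c + u * P + t * P ≡ c + (u + t) * P
          lemma = solve-∀

  ≋-setoid : ℕ → Setoid _ _
  ≋-setoid n = record
    { Carrier = ℤ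
    ; _≈_ = λ a b → a ≋ b [p^ n ]
    ; isEquivalence = record { refl = ≋-refl ; sym = ≋-sym ; trans = ≋-trans }
    }

  module ≋-Reasoning (n : ℕ) where
    open import Relation.Binary.Reasoning.Setoid (≋-setoid n) public

  +-cong : ∀ {a b c d n} → a ≋ b [p^ n ] → c ≋ d [p^ n ] → a + c ≋ b + d [p^ n ]
  +-cong {b = b} {d = d} {n} h₁ h₂ with ≋-elim h₁ | ≋-elim h₂
  ... | t , refl | u , refl = ≋-intro (t + u) (lemma b d t u (p^ n))
    where lemma : ∀ b d t u P → b + t * P + (d + u * P) ≡ b + d + (t + u) * P
          lemma = solve-∀

  neg-cong : ∀ {a b n} → a ≋ b [p^ n ] → - a ≋ - b [p^ n ]
  neg-cong {b = b} {n} h with ≋-elim h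
  ... | t , refl = ≋-intro (- t) (lemma b t (p^ n))
    where lemma : ∀ b t P → - (b + t * P) ≡ - b + (- t) * P
          lemma = solve-∀

  sub-cong : ∀ {a b c d n} → a ≋ b [p^ n ] → c ≋ d [p^ n ] → a - c ≋ b - d [p^ n ]
  sub-cong h₁ h₂ = +-cong h₁ (neg-cong h₂)

  *-cong : ∀ {a b c d n} → a ≋ b [p^ n ] → c ≋ d [p^ n ] → a * c ≋ b * d [p^ n ]
  *-cong {b = b} {d = d} {n} h₁ h₂ with ≋-elim h₁ | ≋-elim h₂
  ... | t , refl | u , refl = ≋-intro (t * d + b * u + t * u * p^ n) (lemma b d t u (p^ n))
    where
      lemma : ∀ b d t u P → (b + t * P) * (d + u * P) ≡ b * d + (t * d + b * u + t * u * P) * P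
      lemma = solve-∀

  ^-cong : ∀ {a b n} k → a ≋ b [p^ n ] → a ^ k ≋ b ^ k [p^ n ]
  ^-cong zero    h = ≋-refl
  ^-cong (suc k) h = *-cong h (^-cong k h)

  *-congˡ : ∀ {a b n} c → a ≋ b [p^ n ] → c * a ≋ c * b [p^ n ]
  *-congˡ c = *-cong (≋-refl {c})

  ≋-p^0 : ∀ {a b} → a ≋ b [p^ 0 ]
  ≋-p^0 {a} {b} = ≋-intro (a - b) (lemma a b)
    where lemma : ∀ a b → a ≡ b + (a - b) * 1ℤ
          lemma = solve-∀

  ≋-cast : ∀ {a b n n′} → n ≡ n′ → a ≋ b [p^ n ] → a ≋ b [p^ n′ ]
  ≋-cast {a} {b} = subst (λ n → a ≋ b [p^ n ])

  +-≋0ʳ : ∀ a {b n} → b ≋ 0ℤ [p^ n ] → a + b ≋ a [p^ n ]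
  +-≋0ʳ a h = ≋-trans (+-cong (≋-refl {a}) h) (≋-reflexive (ℤP.+-identityʳ a))

  ≋-weaken : ∀ {a b} n k → a ≋ b [p^ n ℕ.+ k ] → a ≋ b [p^ n ]
  ≋-weaken {b = b} n k h with ≋-elim h
  ... | t , refl = ≋-intro (t * p^ k) (trans (cong (λ z → b + t * z) (p^-+ n k)) (cong (λ z → b + z) (lemma t (p^ n) (p^ k))))
    where lemma : ∀ t A B → t * (A * B) ≡ t * B * A
          lemma = solve-∀

  ≋-weaken-≤ : ∀ {a b n n′} → n ℕ.≤ n′ → a ≋ b [p^ n′ ] → a ≋ b [p^ n ]
  ≋-weaken-≤ {n = n} n≤n′ h = ≋-weaken n _ (≋-cast (sym (ℕP.m+[n∸m]≡n n≤n′)) h)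

  p^-≋0 : ∀ n → p^ n ≋ 0ℤ [p^ n ]
  p^-≋0 n = ≋-intro 1ℤ (sym (trans (ℤP.+-identityˡ _) (ℤP.*-identityˡ _)))

  ≋0-elim : ∀ {a n} → a ≋ 0ℤ [p^ n ] → ∃ λ t → a ≡ t * p^ n
  ≋0-elim h with ≋-elim h
  ... | t , refl = t , ℤP.+-identityˡ _

  ≋⇒-≋0 : ∀ {a b n} → a ≋ b [p^ n ] → a - b ≋ 0ℤ [p^ n ]
  ≋⇒-≋0 {b = b} {n} h with ≋-elim h
  ... | t , refl = ≋-intro t (lemma b t (p^ n))
    where lemma : ∀ b t P → b + t * P - b ≡ 0ℤ + t * P
          lemma = solve-∀

  *-≋0 : ∀ {a b s t} → a ≋ 0ℤ [p^ s ] → b ≋ 0ℤ [p^ t ] → a * b ≋ 0ℤ [p^ s ℕ.+ t ]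
  *-≋0 {s = s} {t} h₁ h₂ with ≋0-elim h₁ | ≋0-elim h₂
  ... | u , refl | v , refl =
    ≋-intro (u * v) (trans (lemma u v (p^ s) (p^ t)) (cong (λ z → 0ℤ + u * v * z) (sym (p^-+ s t))))
    where lemma : ∀ u v A B → u * A * (v * B) ≡ 0ℤ + u * v * (A * B)
          lemma = solve-∀

  ≋0-*ˡ : ∀ {a n} c → a ≋ 0ℤ [p^ n ] → c * a ≋ 0ℤ [p^ n ]
  ≋0-*ˡ c h = ≋-trans (*-congˡ c h) (≋-reflexive (ℤP.*-zeroʳ c))

  *-congʳ-≋0 : ∀ {a b z s t} → a ≋ b [p^ s ] → z ≋ 0ℤ [p^ t ] → a * z ≋ b * z [p^ s ℕ.+ t ]
  *-congʳ-≋0 {a} {b} {z} h₁ h₂ =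
    ≋-trans (≋-reflexive (lemma a b z)) (+-≋0ʳ (b * z) (*-≋0 (≋⇒-≋0 h₁) h₂))
    where lemma : ∀ a b z → a * z ≡ b * z + (a - b) * z
          lemma = solve-∀

  ^-≋0 : ∀ {a s} k → a ≋ 0ℤ [p^ s ] → a ^ suc k ≋ 0ℤ [p^ suc k ℕ.* s ]
  ^-≋0 {s = s} zero h = ≋-cast (sym (ℕP.+-identityʳ s)) (≋-trans (≋-reflexive (ℤP.*-identityʳ _)) h)
  ^-≋0 (suc k) h = *-≋0 h (^-≋0 k h)

  *-congˡ-≋0 : ∀ {a b z s t} → z ≋ 0ℤ [p^ s ] → a ≋ b [p^ t ] → z * a ≋ z * b [p^ s ℕ.+ t ]
  *-congˡ-≋0 {a} {b} {z} {s} {t} h₁ h₂ = subst₂ (λ u v → u ≋ v [p^ s ℕ.+ t ])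
    (ℤP.*-comm a z) (ℤP.*-comm b z) (≋-cast (ℕP.+-comm t s) (*-congʳ-≋0 h₂ h₁))

  ≋0-*ʳ : ∀ {a n} c → a ≋ 0ℤ [p^ n ] → a * c ≋ 0ℤ [p^ n ]
  ≋0-*ʳ {a} c h = subst (λ u → u ≋ 0ℤ [p^ _ ]) (ℤP.*-comm c a) (≋0-*ˡ c h)

  p^-^ : ∀ a n → (p^ a) ^ n ≡ p^ (n ℕ.* a)
  p^-^ a n = trans (pos-^ (p ℕ.^ a) n) (cong +_ (trans (ℕP.^-*-assoc p a n) (cong (p ℕ.^_) (ℕP.*-comm a n))))

  p≋0 : + p ≋ 0ℤ [p^ 1 ]
  p≋0 = subst (λ a → + a ≋ 0ℤ [p^ 1 ]) (ℕP.*-identityʳ p) (p^-≋0 1)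

choose₂ : ℕ → ℕ
choose₂ zero    = 0
choose₂ (suc n) = choose₂ n ℕ.+ n

choose₂-odd : ∀ h → choose₂ (suc (h ℕ.+ h)) ≡ suc (h ℕ.+ h) ℕ.* h
choose₂-odd zero = refl
choose₂-odd (suc h) rewrite ℕP.+-suc h h | choose₂-odd h = lemma h
  where lemma : ∀ h → suc (h ℕ.+ h) ℕ.* h ℕ.+ suc (h ℕ.+ h) ℕ.+ suc (suc (h ℕ.+ h))
                    ≡ suc (suc (suc (h ℕ.+ h))) ℕ.* suc h
        lemma = ℕS.solve-∀

module PowerLinearisation (p : ℕ) .{{_ : NonZero p}} where
  open import Data.Integer using (_+_; _*_; _-_; _^_)
  open Congruence p

  pow-expansion₁ : ∀ n y c s → y ≋ c [p^ s ] →
    y ^ suc n ≋ c ^ suc n + + suc n * c ^ n * (y - c) [p^ s ℕ.+ s ]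
  pow-expansion₁ zero y c s h = ≋-reflexive (lemma y c)
    where lemma : ∀ y c → y * 1ℤ ≡ c * 1ℤ + 1ℤ * 1ℤ * (y - c)
          lemma = solve-∀
  pow-expansion₁ (suc n) y c s h = begin
    y * y ^ suc n
      ≈⟨ *-congˡ y (pow-expansion₁ n y c s h) ⟩
    y * (c ^ suc n + N * c ^ n * δ)
      ≡⟨ lemma y c (c ^ n) N ⟩
    c ^ suc (suc n) + (1ℤ + N) * c ^ suc n * δ + N * c ^ n * (δ * δ)
      ≈⟨ +-≋0ʳ _ (≋0-*ˡ (N * c ^ n) (*-≋0 (≋⇒-≋0 h) (≋⇒-≋0 h))) ⟩
    c ^ suc (suc n) + (1ℤ + N) * c ^ suc n * δ
      ≡⟨ cong (λ z → c ^ suc (suc n) + z * c ^ suc n * δ) (sym (ℤP.pos-+ 1 (suc n))) ⟩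
    c ^ suc (suc n) + + suc (suc n) * c ^ suc n * δ ∎
    where
      open ≋-Reasoning (s ℕ.+ s)
      N = + suc n
      δ = y - c
      lemma : ∀ y c C N → y * (c * C + N * C * (y - c))
                          ≡ c * (c * C) + (1ℤ + N) * (c * C) * (y - c) + N * C * ((y - c) * (y - c))
      lemma = solve-∀

  pow-expansion₂ : ∀ n y c s → y ≋ c [p^ s ] →
    y ^ suc (suc n) ≋ c ^ suc (suc n) + + suc (suc n) * c ^ suc n * (y - c)
                      + + choose₂ (suc (suc n)) * c ^ n * ((y - c) * (y - c)) [p^ s ℕ.+ (s ℕ.+ s) ]
  pow-expansion₂ zero y c s h = ≋-reflexive (lemma y c)
    where lemma : ∀ y c → y * (y * 1ℤ) ≡ c * (c * 1ℤ) + + 2 * (c * 1ℤ) * (y - c) + 1ℤ * 1ℤ * ((y - c) * (y - c))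
          lemma = solve-∀
  pow-expansion₂ (suc n) y c s h = begin
    y * y ^ suc (suc n)
      ≈⟨ *-congˡ y (pow-expansion₂ n y c s h) ⟩
    y * (c ^ suc (suc n) + N * c ^ suc n * δ + T * c ^ n * (δ * δ))
      ≡⟨ lemma y c (c ^ n) N T ⟩
    c ^ suc (suc (suc n)) + (1ℤ + N) * c ^ suc (suc n) * δ + (T + N) * c ^ suc n * (δ * δ)
      + T * c ^ n * (δ * (δ * δ))
      ≈⟨ +-≋0ʳ _ (≋0-*ˡ (T * c ^ n) (*-≋0 (≋⇒-≋0 h) (*-≋0 (≋⇒-≋0 h) (≋⇒-≋0 h)))) ⟩
    c ^ suc (suc (suc n)) + (1ℤ + N) * c ^ suc (suc n) * δ + (T + N) * c ^ suc n * (δ * δ)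
      ≡⟨ cong₂ (λ u v → c ^ suc (suc (suc n)) + u * c ^ suc (suc n) * δ + v * c ^ suc n * (δ * δ))
               (sym (ℤP.pos-+ 1 (suc (suc n)))) (sym (ℤP.pos-+ (choose₂ (suc (suc n))) (suc (suc n)))) ⟩
    c ^ suc (suc (suc n)) + + suc (suc (suc n)) * c ^ suc (suc n) * δ
      + + choose₂ (suc (suc (suc n))) * c ^ suc n * (δ * δ) ∎
    where
      open ≋-Reasoning (s ℕ.+ (s ℕ.+ s))
      N = + suc (suc n)
      T = + choose₂ (suc (suc n))
      δ = y - c
      lemma : ∀ y c C N T →
        y * (c * (c * C) + N * (c * C) * (y - c) + T * C * ((y - c) * (y - c)))
        ≡ c * (c * (c * C)) + (1ℤ + N) * (c * (c * C)) * (y - c) + (T + N) * (c * C) * ((y - c) * (y - c))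
          + T * C * ((y - c) * ((y - c) * (y - c)))
      lemma = solve-∀

  LinearPower : ℕ → ℕ → Set
  LinearPower a A = (+ a ≋ 0ℤ [p^ A ]) ×
    (∀ y c s → 1 ℕ.≤ s → y ≋ c [p^ s ] → y ^ a ≋ c ^ a + + a * c ^ (a ℕ.∸ 1) * (y - c) [p^ A ℕ.+ (s ℕ.+ s) ])

  linearPower-suc : ∀ n → LinearPower (suc n) 0
  linearPower-suc n = ≋-p^0 , λ y c s _ → pow-expansion₁ n y c s

  linearPower-choose₂ : ∀ n → + suc (suc n) ≋ 0ℤ [p^ 1 ] → + choose₂ (suc (suc n)) ≋ 0ℤ [p^ 1 ] →
                        LinearPower (suc (suc n)) 1
  linearPower-choose₂ n a≋0 choose≋0 = a≋0 , expansion
    where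
      expansion : ∀ y c s → 1 ℕ.≤ s → y ≋ c [p^ s ] →
        y ^ suc (suc n) ≋ c ^ suc (suc n) + + suc (suc n) * c ^ suc n * (y - c) [p^ 1 ℕ.+ (s ℕ.+ s) ]
      expansion y c (suc s) _ h = ≋-trans
        (≋-weaken _ s (≋-cast (lemma s) (pow-expansion₂ n y c (suc s) h)))
        (+-≋0ʳ _ (≋-trans (≋-reflexive (ℤP.*-assoc T (c ^ n) (δ * δ)))
                          (*-≋0 choose≋0 (≋0-*ˡ (c ^ n) (*-≋0 (≋⇒-≋0 h) (≋⇒-≋0 h))))))
        where
          T = + choose₂ (suc (suc n))
          δ = y - c
          lemma : ∀ s → suc s ℕ.+ (suc s ℕ.+ suc s) ≡ 1 ℕ.+ (suc s ℕ.+ suc s) ℕ.+ s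
          lemma = ℕS.solve-∀

  linearPower-odd : ∀ h → p ≡ suc (h ℕ.+ h) → 1 ℕ.≤ h → LinearPower p 1
  linearPower-odd (suc h) p≡ _ = subst (λ a → LinearPower a 1) (sym p≡)
    (linearPower-choose₂ (h ℕ.+ suc h) (subst (λ a → + a ≋ 0ℤ [p^ 1 ]) p≡ p≋0)
      (subst (λ a → + a ≋ 0ℤ [p^ 1 ]) (sym (trans (choose₂-odd (suc h)) (cong (ℕ._* suc h) (sym p≡))))
        (≋-trans (≋-reflexive (ℤP.pos-* p (suc h))) (≋0-*ʳ (+ suc h) p≋0))))

  linearPower-* : ∀ {a b A B} → LinearPower a A → LinearPower b B → 1 ℕ.≤ a → 1 ℕ.≤ b →
                  LinearPower (a ℕ.* b) (A ℕ.+ B)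
  linearPower-* {suc a} {suc b} {A} {B} (a≋0 , linear-a) (b≋0 , linear-b) _ _ =
    ≋-trans (≋-reflexive (ℤP.pos-* (suc a) (suc b))) (*-≋0 a≋0 b≋0)
    , expansion
    where
      expansion : ∀ y c s → 1 ℕ.≤ s → y ≋ c [p^ s ] →
        y ^ (suc a ℕ.* suc b) ≋ c ^ (suc a ℕ.* suc b) + + (suc a ℕ.* suc b) * c ^ (suc a ℕ.* suc b ℕ.∸ 1) * (y - c)
          [p^ A ℕ.+ B ℕ.+ (s ℕ.+ s) ]
      expansion y c s 1≤s h = begin
        y ^ (suc a ℕ.* suc b)             ≡⟨ sym (ℤP.^-*-assoc y (suc a) (suc b)) ⟩
        Y ^ suc b                         ≈⟨ ≋-weaken _ A (≋-cast (lemma₁ A B s) (linear-b Y C (A ℕ.+ s) 1≤A+s Y≋C)) ⟩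
        C ^ suc b + + suc b * C ^ b * (Y - C)
          ≈⟨ +-cong (≋-refl {C ^ suc b}) (≋-cast (lemma₂ A B s) (*-congˡ-≋0 (≋0-*ʳ (C ^ b) b≋0) Y-C≋T)) ⟩
        C ^ suc b + + suc b * C ^ b * T   ≡⟨ collect ⟩
        c ^ (suc a ℕ.* suc b) + + (suc a ℕ.* suc b) * c ^ (suc a ℕ.* suc b ℕ.∸ 1) * (y - c) ∎
        where
          open ≋-Reasoning (A ℕ.+ B ℕ.+ (s ℕ.+ s))
          Y = y ^ suc a
          C = c ^ suc a
          T = + suc a * c ^ a * (y - c)
          Y≋C+T : Y ≋ C + T [p^ A ℕ.+ (s ℕ.+ s) ]
          Y≋C+T = linear-a y c s 1≤s h
          T≋0 : T ≋ 0ℤ [p^ A ℕ.+ s ]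
          T≋0 = ≋-trans (≋-reflexive (ℤP.*-assoc (+ suc a) (c ^ a) (y - c))) (*-≋0 a≋0 (≋0-*ˡ (c ^ a) (≋⇒-≋0 h)))
          Y≋C : Y ≋ C [p^ A ℕ.+ s ]
          Y≋C = ≋-trans (≋-weaken _ s (≋-cast (sym (ℕP.+-assoc A s s)) Y≋C+T)) (+-≋0ʳ C T≋0)
          Y-C≋T : Y - C ≋ T [p^ A ℕ.+ (s ℕ.+ s) ]
          Y-C≋T = ≋-trans (sub-cong Y≋C+T (≋-refl {C})) (≋-reflexive (lemma C T))
            where lemma : ∀ C T → C + T - C ≡ T
                  lemma = solve-∀
          1≤A+s : 1 ℕ.≤ A ℕ.+ s
          1≤A+s = ℕP.≤-trans 1≤s (ℕP.m≤n+m s A)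
          lemma₁ : ∀ A B s → B ℕ.+ ((A ℕ.+ s) ℕ.+ (A ℕ.+ s)) ≡ A ℕ.+ B ℕ.+ (s ℕ.+ s) ℕ.+ A
          lemma₁ = ℕS.solve-∀
          lemma₂ : ∀ A B s → B ℕ.+ (A ℕ.+ (s ℕ.+ s)) ≡ A ℕ.+ B ℕ.+ (s ℕ.+ s)
          lemma₂ = ℕS.solve-∀
          exponent : suc a ℕ.* b ℕ.+ a ≡ suc a ℕ.* suc b ℕ.∸ 1
          exponent = lemma a b
            where lemma : ∀ a b → suc a ℕ.* b ℕ.+ a ≡ b ℕ.+ a ℕ.* suc b
                  lemma = ℕS.solve-∀
          collect : C ^ suc b + + suc b * C ^ b * T
                    ≡ c ^ (suc a ℕ.* suc b) + + (suc a ℕ.* suc b) * c ^ (suc a ℕ.* suc b ℕ.∸ 1) * (y - c)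
          collect = cong₂ _+_ (ℤP.^-*-assoc c (suc a) (suc b))
            (trans (lemma (+ suc b) (C ^ b) (+ suc a) (c ^ a) (y - c))
              (cong₂ (λ u v → u * v * (y - c)) (sym (ℤP.pos-* (suc a) (suc b)))
                (trans (cong (_* c ^ a) (ℤP.^-*-assoc c (suc a) b))
                  (trans (sym (ℤP.^-distribˡ-+-* c (suc a ℕ.* b) a)) (cong (c ^_) exponent)))))
            where lemma : ∀ B X A Z D → B * X * (A * Z * D) ≡ A * B * (X * Z) * D
                  lemma = solve-∀

  linearPower-p^ : LinearPower p 1 → ∀ e → LinearPower (p ℕ.^ e) e
  linearPower-p^ linear-p zero    = linearPower-suc 0
  linearPower-p^ linear-p (suc e) =
    linearPower-* linear-p (linearPower-p^ linear-p e) (ℕ.>-nonZero⁻¹ p) (ℕP.m^n>0 p e)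

∣∸⇒≡ : ∀ {a b N} → a ℕ.≤ b → b ℕ.< N → N ℕDv.∣ b ℕ.∸ a → a ≡ b
∣∸⇒≡ {a} {b} a≤b b<N N∣b∸a with b ℕ.∸ a in eq
... | zero  = ℕP.≤-antisym a≤b (ℕP.m∸n≡0⇒m≤n eq)
... | suc _ = ⊥-elim (ℕDv.>⇒∤ (ℕP.≤-<-trans (subst (ℕ._≤ b) eq (ℕP.m∸n≤m b a)) b<N) N∣b∸a)

infix 5 _∈[_,_⟩
_∈[_,_⟩ : ℕ → ℕ → ℕ → Bool
i ∈[ f , R ⟩ = (i <ᵇ R) ∧ not (i <ᵇ f)

module FiniteSums where
  open import Data.Integer using (_+_; _*_; _-_)

  sumTo : ℕ → (ℕ → ℤ) → ℤ
  sumTo zero    g = 0ℤ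
  sumTo (suc k) g = g 0 + sumTo k (λ i → g (suc i))

  sumTo-ext : ∀ k {a b : ℕ → ℤ} → (∀ i → a i ≡ b i) → sumTo k a ≡ sumTo k b
  sumTo-ext zero    a≡b = refl
  sumTo-ext (suc k) a≡b = cong₂ _+_ (a≡b 0) (sumTo-ext k (λ i → a≡b (suc i)))

  sumTo-zero : ∀ k → sumTo k (λ _ → 0ℤ) ≡ 0ℤ
  sumTo-zero zero    = refl
  sumTo-zero (suc k) = trans (ℤP.+-identityˡ _) (sumTo-zero k)

  sumTo-*ʳ : ∀ k (c : ℕ → ℤ) D → sumTo k (λ i → c i * D) ≡ sumTo k c * D
  sumTo-*ʳ zero    c D = refl
  sumTo-*ʳ (suc k) c D = trans (cong (λ z → c 0 * D + z) (sumTo-*ʳ k (λ i → c (suc i)) D))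
                                (sym (ℤP.*-distribʳ-+ D (c 0) _))

  sumTo-linear : ∀ k (a c : ℕ → ℤ) D → sumTo k (λ i → a i + c i * D) ≡ sumTo k a + sumTo k c * D
  sumTo-linear zero    a c D = refl
  sumTo-linear (suc k) a c D =
    trans (cong (λ z → a 0 + c 0 * D + z) (sumTo-linear k (λ i → a (suc i)) (λ i → c (suc i)) D))
          (lemma (a 0) (c 0) (sumTo k (λ i → a (suc i))) (sumTo k (λ i → c (suc i))) D)
    where lemma : ∀ a c A C D → a + c * D + (A + C * D) ≡ a + A + (c + C) * D
          lemma = solve-∀

  sumTo-interval : ∀ k R f → f ℕ.≤ R → R ℕ.≤ k →
                   sumTo k (λ i → if i ∈[ f , R ⟩ then 1ℤ else 0ℤ) ≡ + R - + f
  sumTo-interval zero    zero    zero    _         _         = refl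
  sumTo-interval (suc k) zero    zero    _         _         = sumTo-zero (suc k)
  sumTo-interval (suc k) (suc R) zero    _         (s≤s R≤k) =
    trans (cong (λ z → 1ℤ + z) (sumTo-interval k R zero z≤n R≤k)) (lemma (+ R))
    where lemma : ∀ R → 1ℤ + (R - 0ℤ) ≡ 1ℤ + R - 0ℤ
          lemma = solve-∀
  sumTo-interval (suc k) (suc R) (suc f) (s≤s f≤R) (s≤s R≤k) =
    trans (ℤP.+-identityˡ _) (trans (sumTo-interval k R f f≤R R≤k)
          (trans (lemma (+ R) (+ f)) (sym (cong₂ _-_ (ℤP.pos-+ 1 R) (ℤP.pos-+ 1 f)))))
    where lemma : ∀ R f → R - f ≡ 1ℤ + R - (1ℤ + f)
          lemma = solve-∀

open FiniteSums

module Residues (p : ℕ) .{{_ : NonZero p}} where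
  open import Data.Integer using (_+_; _*_; _-_; _^_; _⊖_)
  open Congruence p

  modP≋ : ∀ n a → + modP p n a ≋ + a [p^ n ]
  modP≋ n a = ≋-sym (≋-intro (+ q) (trans (cong +_ (ℕD.m≡m%n+[m/n]*n a (p ℕ.^ n) {{ℕP.m^n≢0 p n}}))
    (trans (ℤP.pos-+ (modP p n a) (q ℕ.* p ℕ.^ n)) (cong (λ z → + modP p n a + z) (ℤP.pos-* q (p ℕ.^ n))))))
    where q = ℕD._/_ a (p ℕ.^ n) {{ℕP.m^n≢0 p n}}

  modP< : ∀ n a → modP p n a ℕ.< p ℕ.^ n
  modP< n a = ℕD.m%n<n a (p ℕ.^ n) {{ℕP.m^n≢0 p n}}

  ∣∸-of-≋ : ∀ {a b n} → a ℕ.≤ b → + b ≋ + a [p^ n ] → p ℕ.^ n ℕDv.∣ b ℕ.∸ a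
  ∣∸-of-≋ {a} {b} {n} a≤b (mod p^n∣b-a) =
    subst (p ℕ.^ n ℕDv.∣_) (cong ∣_∣ (trans (ℤP.m-n≡m⊖n b a) (ℤP.⊖-≥ a≤b))) (∣⇒∣ᵤ p^n∣b-a)

  residue-unique : ∀ {a b n} → a ℕ.< p ℕ.^ n → b ℕ.< p ℕ.^ n → + a ≋ + b [p^ n ] → a ≡ b
  residue-unique {a} {b} a< b< a≋b with ℕP.≤-total a b
  ... | inj₁ a≤b = ∣∸⇒≡ a≤b b< (∣∸-of-≋ a≤b (≋-sym a≋b))
  ... | inj₂ b≤a = sym (∣∸⇒≡ b≤a a< (∣∸-of-≋ b≤a a≋b))

  residue-step : (z : Zp p) → ∀ L → + proj₁ z (suc L) ≋ + proj₁ z L [p^ L ]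
  residue-step z L = subst (λ r → + proj₁ z (suc L) ≋ + r [p^ L ]) (proj₂ (proj₂ z) L) (≋-sym (modP≋ L _))

  residue-coherent : (z : Zp p) → ∀ {M L} → M ℕ.≤ L → + proj₁ z L ≋ + proj₁ z M [p^ M ]
  residue-coherent z {M} M≤L = subst (λ L → + proj₁ z L ≋ + proj₁ z M [p^ M ]) (ℕP.m+[n∸m]≡n M≤L) (from _)
    where
      from : ∀ k → + proj₁ z (M ℕ.+ k) ≋ + proj₁ z M [p^ M ]
      from zero    = ≋-reflexive (cong (λ n → + proj₁ z n) (ℕP.+-identityʳ M))
      from (suc k) = ≋-trans
        (subst (λ n → + proj₁ z n ≋ + proj₁ z (M ℕ.+ k) [p^ M ]) (sym (ℕP.+-suc M k))
          (≋-weaken M k (residue-step z (M ℕ.+ k))))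
        (from k)

  addZ≋ : ∀ x y n → + addZ p x y n ≋ + x n + + y n [p^ n ]
  addZ≋ x y n = ≋-trans (modP≋ n (x n ℕ.+ y n)) (≋-reflexive (ℤP.pos-+ (x n) (y n)))

  mulZ≋ : ∀ x y n → + mulZ p x y n ≋ + x n * + y n [p^ n ]
  mulZ≋ x y n = ≋-trans (modP≋ n (x n ℕ.* y n)) (≋-reflexive (ℤP.pos-* (x n) (y n)))

  powZ≋ : ∀ x k n → + powZ p x k n ≋ (+ x n) ^ k [p^ n ]
  powZ≋ x zero    n = modP≋ n 1
  powZ≋ x (suc k) n = ≋-trans (mulZ≋ x (powZ p x k) n) (*-congˡ (+ x n) (powZ≋ x k n))

  minusOneZ≋ : ∀ n → + minusOneZ p n ≋ -1ℤ [p^ n ]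
  minusOneZ≋ n = ≋-intro 1ℤ (begin
    + (p ℕ.^ n ℕ.∸ 1)   ≡⟨ ℤP.⊖-≥ (ℕP.m^n>0 p n) ⟨
    p ℕ.^ n ⊖ 1         ≡⟨ ℤP.m-n≡m⊖n (p ℕ.^ n) 1 ⟨
    p^ n - 1ℤ           ≡⟨ lemma (p^ n) ⟩
    -1ℤ + 1ℤ * p^ n     ∎)
    where
      open ≡-Reasoning
      lemma : ∀ P → P - 1ℤ ≡ -1ℤ + 1ℤ * P
      lemma = solve-∀

  cantorTerm : ℤ → (ℕ → Bool) → ℕ → ℤ
  cantorTerm G b N = if b N then (G + -1ℤ) * G ^ N else 0ℤ

  cantorSum : ℤ → (ℕ → Bool) → ℕ → ℤ
  cantorSum G b zero    = 0ℤ
  cantorSum G b (suc N) = cantorSum G b N + cantorTerm G b N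

  partialSum≋ : ∀ γ b N n → + partialSum p γ b N n ≋ cantorSum (+ γ n) b N [p^ n ]
  partialSum≋ γ b zero    n = ≋-refl
  partialSum≋ γ b (suc N) n = ≋-trans (addZ≋ (partialSum p γ b N) term n) (+-cong (partialSum≋ γ b N n) term≋)
    where
      term = if b N then mulZ p (addZ p γ (minusOneZ p)) (powZ p γ N) else zeroZ p
      term≋ : + term n ≋ cantorTerm (+ γ n) b N [p^ n ]
      term≋ with b N
      ... | true  = ≋-trans (mulZ≋ (addZ p γ (minusOneZ p)) (powZ p γ N) n)
                      (*-cong (≋-trans (addZ≋ γ (minusOneZ p) n) (+-cong (≋-refl {+ γ n}) (minusOneZ≋ n))) (powZ≋ γ N n))
      ... | false = ≋-refl

  partialSum< : ∀ γ b N n → partialSum p γ b N n ℕ.< p ℕ.^ n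
  partialSum< γ b zero    n = ℕP.m^n>0 p n
  partialSum< γ b (suc N) n = modP< n _

  sumPow< : ∀ k xs m n → sumPow p k xs m n ℕ.< p ℕ.^ n
  sumPow< zero    xs m n = ℕP.m^n>0 p n
  sumPow< (suc k) xs m n = modP< n _

  sumTo-cong : ∀ {n} k {a b : ℕ → ℤ} → (∀ i → a i ≋ b i [p^ n ]) → sumTo k a ≋ sumTo k b [p^ n ]
  sumTo-cong zero    a≋b = ≋-refl
  sumTo-cong (suc k) a≋b = +-cong (a≋b 0) (sumTo-cong k (λ i → a≋b (suc i)))

  sumPow≋ : ∀ k (xs : ℕ → Raw) m n →
            + sumPow p k (λ i → xs (toℕ i)) m n ≋ sumTo k (λ i → (+ xs i n) ^ m) [p^ n ]
  sumPow≋ zero    xs m n = ≋-refl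
  sumPow≋ (suc k) xs m n =
    ≋-trans (addZ≋ (powZ p (xs 0) m) (sumPow p k (λ i → xs (suc (toℕ i))) m) n)
            (+-cong (powZ≋ (xs 0) m n) (sumPow≋ k (λ i → xs (suc i)) m n))

  cantorTerm-cong : ∀ {G G′ n} b N → G ≋ G′ [p^ n ] → cantorTerm G b N ≋ cantorTerm G′ b N [p^ n ]
  cantorTerm-cong b N G≋G′ with b N
  ... | true  = *-cong (+-cong G≋G′ ≋-refl) (^-cong N G≋G′)
  ... | false = ≋-refl

  cantorSum-cong : ∀ {G G′ n} b N → G ≋ G′ [p^ n ] → cantorSum G b N ≋ cantorSum G′ b N [p^ n ]
  cantorSum-cong b zero    G≋G′ = ≋-refl
  cantorSum-cong b (suc N) G≋G′ = +-cong (cantorSum-cong b N G≋G′) (cantorTerm-cong b N G≋G′)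

  cantorSum-ext : ∀ G {b b′} N → (∀ j → j ℕ.< N → b j ≡ b′ j) → cantorSum G b N ≡ cantorSum G b′ N
  cantorSum-ext G zero    b≡b′ = refl
  cantorSum-ext G (suc N) b≡b′ = cong₂ _+_
    (cantorSum-ext G N (λ j j<N → b≡b′ j (ℕP.m<n⇒m<1+n j<N)))
    (cong (λ bit → if bit then (G + -1ℤ) * G ^ N else 0ℤ) (b≡b′ N ℕP.≤-refl))

  cantorTerm-≋0 : ∀ {G s} b N → G ≋ 0ℤ [p^ s ] → cantorTerm G b (suc N) ≋ 0ℤ [p^ suc N ℕ.* s ]
  cantorTerm-≋0 {G} b N G≋0 with b (suc N)
  ... | true  = ≋0-*ˡ (G + -1ℤ) (^-≋0 N G≋0)
  ... | false = ≋-refl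

  cantorSum-stable : ∀ {G} b → G ≋ 0ℤ [p^ 1 ] → ∀ n k → cantorSum G b (n ℕ.+ k) ≋ cantorSum G b n [p^ n ]
  cantorSum-stable b G≋0 n zero    = ≋-reflexive (cong (cantorSum _ b) (ℕP.+-identityʳ n))
  cantorSum-stable {G} b G≋0 n (suc k) = ≋-trans
    (≋-reflexive (cong (cantorSum G b) (ℕP.+-suc n k)))
    (≋-trans (+-cong (cantorSum-stable b G≋0 n k) (tail≋0 n (ℕP.m≤m+n n k))) (≋-reflexive (ℤP.+-identityʳ _)))
    where
      tail≋0 : ∀ n {N} → n ℕ.≤ N → cantorTerm G b N ≋ 0ℤ [p^ n ]
      tail≋0 zero    _               = ≋-p^0
      tail≋0 (suc n) {suc N} (s≤s n≤N) =
        ≋-weaken-≤ (s≤s n≤N) (≋-cast (cong suc (ℕP.*-identityʳ N)) (cantorTerm-≋0 b N G≋0))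

  cantorSum-≋-1 : ∀ {G d} b N → b 0 ≡ true → G ≋ 0ℤ [p^ d ] → cantorSum G b (suc N) ≋ -1ℤ [p^ d ]
  cantorSum-≋-1 {G} b zero b₀ G≋0 rewrite b₀ =
    ≋-trans (≋-reflexive (lemma G)) (+-cong G≋0 (≋-refl { -1ℤ}))
    where lemma : ∀ G → 0ℤ + (G + -1ℤ) * 1ℤ ≡ G + -1ℤ
          lemma = solve-∀
  cantorSum-≋-1 {d = d} b (suc N) b₀ G≋0 =
    ≋-trans (+-cong (cantorSum-≋-1 b N b₀ G≋0) (≋-weaken d (N ℕ.* d) (cantorTerm-≋0 b N G≋0)))
            (≋-reflexive (ℤP.+-identityʳ -1ℤ))

module UnitsModPrime (p : ℕ) .{{_ : NonZero p}} (p-prime : Prime p) where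
  open import Data.Integer using (_+_; _*_; _-_; _^_; -_)
  open Congruence p

  infix 4 p∤_
  p∤_ : ℤ → Set
  p∤ a = ¬ (a ≋ 0ℤ [p^ 1 ])

  ≋0⇒p∣ : ∀ {a} → a ≋ 0ℤ [p^ 1 ] → p ℕDv.∣ ∣ a ∣
  ≋0⇒p∣ {a} (mod p∣a) = subst₂ ℕDv._∣_ (ℕP.*-identityʳ p) (cong ∣_∣ (ℤP.+-identityʳ a)) (∣⇒∣ᵤ p∣a)

  p∣⇒≋0 : ∀ {a} → p ℕDv.∣ ∣ a ∣ → a ≋ 0ℤ [p^ 1 ]
  p∣⇒≋0 {a} p∣a =
    mod (∣ᵤ⇒∣ (subst₂ ℕDv._∣_ (sym (ℕP.*-identityʳ p)) (cong ∣_∣ (sym (ℤP.+-identityʳ a))) p∣a))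

  p∤-* : ∀ {a b} → p∤ a → p∤ b → p∤ a * b
  p∤-* {a} {b} p∤a p∤b ab≋0
    with euclidsLemma ∣ a ∣ ∣ b ∣ p-prime (subst (p ℕDv.∣_) (ℤP.abs-* a b) (≋0⇒p∣ ab≋0))
  ... | inj₁ p∣a = p∤a (p∣⇒≋0 p∣a)
  ... | inj₂ p∣b = p∤b (p∣⇒≋0 p∣b)

  p∤1 : p∤ 1ℤ
  p∤1 1≋0 = ¬prime[1] (subst Prime (ℕDv.∣1⇒≡1 (≋0⇒p∣ 1≋0)) p-prime)

  p∤-1 : p∤ -1ℤ
  p∤-1 -1≋0 = p∤1 (neg-cong -1≋0)

  p∤-^ : ∀ {a} n → p∤ a → p∤ a ^ n
  p∤-^ zero    p∤a = p∤1
  p∤-^ (suc n) p∤a = p∤-* p∤a (p∤-^ n p∤a)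

  p∤⇒coprime : ∀ {a} → p∤ a → Coprime p ∣ a ∣
  p∤⇒coprime p∤a (d∣p , d∣a) with prime⇒irreducible p-prime d∣p
  ... | inj₁ d≡1 = d≡1
  ... | inj₂ refl = ⊥-elim (p∤a (p∣⇒≋0 d∣a))

  ≋1-of-≡ : ∀ {a} t → a ≡ 1ℤ + t * + p → a ≋ 1ℤ [p^ 1 ]
  ≋1-of-≡ t refl = +-≋0ʳ 1ℤ (≋0-*ˡ t p≋0)

  bézout-ℤ : ∀ {a b c d} → 1 ℕ.+ a ℕ.* b ≡ c ℕ.* d → 1ℤ + + a * + b ≡ + c * + d
  bézout-ℤ {a} {b} {c} {d} eq = begin
    1ℤ + + a * + b     ≡⟨ cong (λ z → 1ℤ + z) (ℤP.pos-* a b) ⟨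
    + (1 ℕ.+ a ℕ.* b)  ≡⟨ cong +_ eq ⟩
    + (c ℕ.* d)        ≡⟨ ℤP.pos-* c d ⟩
    + c * + d          ∎
    where open ≡-Reasoning

  inverse-ℕ : ∀ n → Coprime p n → ∃ λ u → u * + n ≋ 1ℤ [p^ 1 ]
  inverse-ℕ n coprime with coprime-Bézout coprime
  ... | Bézout.+- x y eq = - + y , ≋1-of-≡ (- + x) (begin
    - + y * + n              ≡⟨ lemma₁ (+ y) (+ n) ⟩
    1ℤ - (1ℤ + + y * + n)    ≡⟨ cong (λ z → 1ℤ - z) (bézout-ℤ {y} {n} {x} {p} eq) ⟩
    1ℤ - + x * + p           ≡⟨ lemma₂ (+ x) (+ p) ⟩
    1ℤ + - + x * + p         ∎)
    where
      open ≡-Reasoning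
      lemma₁ : ∀ Y N → - Y * N ≡ 1ℤ - (1ℤ + Y * N)
      lemma₁ = solve-∀
      lemma₂ : ∀ X P → 1ℤ - X * P ≡ 1ℤ + - X * P
      lemma₂ = solve-∀
  ... | Bézout.-+ x y eq = + y , ≋1-of-≡ (+ x) (sym (bézout-ℤ {x} {p} {y} {n} eq))

  inverse-mod-p : ∀ {w} → p∤ w → ∃ λ u → u * w ≋ 1ℤ [p^ 1 ]
  inverse-mod-p {+ n}        p∤w = inverse-ℕ n (p∤⇒coprime p∤w)
  inverse-mod-p { -[1+ n ] } p∤w with inverse-ℕ (suc n) (p∤⇒coprime p∤w)
  ... | u , u*w≋1 = - u , ≋-trans (≋-reflexive (lemma u (+ suc n))) u*w≋1
    where lemma : ∀ u N → - u * - N ≡ u * N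
          lemma = solve-∀

  -- Newton's iteration u ↦ u (2 - u w) doubles the precision of an inverse.
  inverse-mod-p^ : ∀ {w} → p∤ w → ∀ n → ∃ λ u → u * w ≋ 1ℤ [p^ n ]
  inverse-mod-p^ p∤w zero          = 0ℤ , ≋-p^0
  inverse-mod-p^ p∤w (suc zero)    = inverse-mod-p p∤w
  inverse-mod-p^ {w} p∤w (suc (suc n)) with inverse-mod-p^ p∤w (suc n)
  ... | u , u*w≋1 = u * (+ 2 - u * w) , ≋-weaken (suc (suc n)) n (≋-cast (lemmaℕ n) (≋-trans
          (≋-reflexive (lemma u w)) (+-≋0ʳ 1ℤ (neg-cong (*-≋0 (≋⇒-≋0 u*w≋1) (≋⇒-≋0 u*w≋1))))))
    where
      lemma : ∀ u w → u * (+ 2 - u * w) * w ≡ 1ℤ + - ((u * w - 1ℤ) * (u * w - 1ℤ))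
      lemma = solve-∀
      lemmaℕ : ∀ n → suc n ℕ.+ suc n ≡ suc (suc n) ℕ.+ n
      lemmaℕ = ℕS.solve-∀

  solve-≋-below : ∀ {w} d → p∤ w → ∀ R t → p ℕ.^ d ℕ.∸ 1 ℕ.≤ R →
                  ∃ λ f → f ℕ.≤ R × (+ R - + f) * w ≋ t [p^ d ]
  solve-≋-below {w} d p∤w R t p^d∸1≤R = f , f≤R , (begin
    (+ R - + f) * w          ≈⟨ *-cong (sub-cong (≋-refl {+ R}) f≋a) (≋-refl {w}) ⟩
    (+ R - (+ R - u * t)) * w ≡⟨ lemma (+ R) u t w ⟩
    u * w * t                ≈⟨ *-cong u*w≋1 (≋-refl {t}) ⟩
    1ℤ * t                   ≡⟨ ℤP.*-identityˡ t ⟩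
    t                        ∎)
    where
      open ≋-Reasoning d
      instance _ = ℕP.m^n≢0 p d
      u = proj₁ (inverse-mod-p^ p∤w d)
      u*w≋1 = proj₂ (inverse-mod-p^ p∤w d)
      a = + R - u * t
      f = a ℤD.%ℕ p ℕ.^ d
      f≋a : + f ≋ a [p^ d ]
      f≋a = ≋-sym (≋-intro (a ℤD./ℕ p ℕ.^ d) (ℤD.a≡a%ℕn+[a/ℕn]*n a (p ℕ.^ d)))
      f≤R : f ℕ.≤ R
      f≤R = ℕP.≤-trans (ℕP.<⇒≤pred (ℤD.n%ℕd<d a (p ℕ.^ d))) p^d∸1≤R
      lemma : ∀ R u t w → (R - (R - u * t)) * w ≡ u * w * t
      lemma = solve-∀

even-or-odd : ∀ n → ∃ λ h → n ≡ h ℕ.+ h ⊎ n ≡ suc (h ℕ.+ h)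
even-or-odd zero = 0 , inj₁ refl
even-or-odd (suc n) with even-or-odd n
... | h , inj₁ refl = h , inj₂ refl
... | h , inj₂ refl = suc h , inj₁ (cong suc (sym (ℕP.+-suc h h)))

odd-prime : ∀ {p} → Prime p → 3 ℕ.≤ p → ∃ λ h → p ≡ suc (h ℕ.+ h) × 1 ℕ.≤ h
odd-prime {p} p-prime 3≤p with even-or-odd p
... | h     , inj₁ p≡h+h =
  ⊥-elim ([ (λ ()) , ℕP.<⇒≢ 3≤p ]′ (prime⇒irreducible p-prime (ℕDv.divides h (trans p≡h+h (lemma h)))))
  where lemma : ∀ h → h ℕ.+ h ≡ h ℕ.* 2
        lemma = ℕS.solve-∀
... | zero  , inj₂ refl = ⊥-elim (ℕP.≤⇒≯ 3≤p (s≤s (s≤s z≤n)))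
... | suc h , inj₂ refl = suc h , refl , s≤s z≤n

-- This is where the number k = Q (p ^ e + 1) - 2 of summands comes from.
count-bound : ∀ Q A r → 1 ℕ.≤ Q → r ℕ.< A ℕ.* Q → Q ℕ.∸ 1 ℕ.+ r ℕ.≤ Q ℕ.* (A ℕ.+ 1) ℕ.∸ 2
count-bound (suc q) A r _ r<A*Q = begin
  q ℕ.+ r                     ≡⟨ ℕP.m+n∸m≡n 2 (q ℕ.+ r) ⟨
  2 ℕ.+ (q ℕ.+ r) ℕ.∸ 2       ≤⟨ ℕP.∸-monoˡ-≤ 2 (subst₂ ℕ._≤_ (lemma₁ q r) (lemma₂ q A)
                                                    (ℕP.+-monoˡ-≤ (suc q) r<A*Q)) ⟩
  suc q ℕ.* (A ℕ.+ 1) ℕ.∸ 2   ∎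
  where
    open ℕP.≤-Reasoning
    lemma₁ : ∀ q r → suc r ℕ.+ suc q ≡ 2 ℕ.+ (q ℕ.+ r)
    lemma₁ = ℕS.solve-∀
    lemma₂ : ∀ q A → A ℕ.* suc q ℕ.+ suc q ≡ suc q ℕ.* (A ℕ.+ 1)
    lemma₂ = ℕS.solve-∀

update : (ℕ → ℕ) → ℕ → ℕ → ℕ → ℕ
update φ t v u with u ℕ.≟ t
... | yes _ = v
... | no  _ = φ u

update-same : ∀ φ t v → update φ t v t ≡ v
update-same φ t v with t ℕ.≟ t
... | yes _ = refl
... | no t≢t = ⊥-elim (t≢t refl)

update-other : ∀ φ t v u → u ≢ t → update φ t v u ≡ φ u
update-other φ t v u u≢t with u ℕ.≟ t
... | yes u≡t = ⊥-elim (u≢t u≡t)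
... | no  _   = refl

module Construction (p : ℕ) .{{_ : NonZero p}} (p-prime : Prime p) (3≤p : 3 ℕ.≤ p)
    (γ : Zp p) (γ₁≡0 : proj₁ γ 1 ≡ 0) (d : ℕ) (v[γ]≡d : ValZp p (proj₁ γ) d) (2<p^d : 2 ℕ.< p ℕ.^ d)
    (m : ℕ) (2≤m : 2 ℕ.≤ m) (e : ℕ) (v[m]≡e : ValNat p m e) where
  open import Data.Integer using (_+_; _*_; _-_; _^_; -_)
  open Congruence p
  open Residues p
  open PowerLinearisation p
  open UnitsModPrime p p-prime

  1≤d : 1 ℕ.≤ d
  1≤d = positive d 2<p^d
    where positive : ∀ d → 2 ℕ.< p ℕ.^ d → 1 ℕ.≤ d
          positive zero    (s≤s ())
          positive (suc d) _ = s≤s z≤n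

  γ-at : ℕ → ℤ
  γ-at n = + proj₁ γ n

  γ≋0[p] : ∀ L → γ-at L ≋ 0ℤ [p^ 1 ]
  γ≋0[p] zero    = ≋-reflexive (cong +_ (ℕP.n<1⇒n≡0 (proj₁ (proj₂ γ) 0)))
  γ≋0[p] (suc L) = ≋-trans (residue-coherent γ (s≤s z≤n)) (≋-reflexive (cong +_ γ₁≡0))

  γ≋0[p^d] : ∀ {L} → d ℕ.≤ L → γ-at L ≋ 0ℤ [p^ d ]
  γ≋0[p^d] d≤L = ≋-trans (residue-coherent γ d≤L) (≋-reflexive (cong +_ (proj₁ v[γ]≡d)))

  γ-unit-part : ∀ {L} → suc d ℕ.≤ L → ∃ λ g → p∤ g × γ-at L ≡ g * p^ d
  γ-unit-part d<L with ≋0-elim (γ≋0[p^d] (ℕP.<⇒≤ d<L))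
  ... | g , γ≡g*p^d = g , p∤g , γ≡g*p^d
    where
      p∤g : p∤ g
      p∤g g≋0 = proj₂ v[γ]≡d (residue-unique (proj₁ (proj₂ γ) (suc d)) (ℕP.m^n>0 p (suc d))
        (≋-trans (≋-sym (residue-coherent γ d<L))
          (subst (λ z → z ≋ 0ℤ [p^ suc d ]) (sym γ≡g*p^d)
            (≋-trans (*-≋0 g≋0 (p^-≋0 d)) (≋-reflexive (ℤP.*-zeroˡ 0ℤ))))))

  p∤γ-1 : ∀ L → p∤ γ-at L + -1ℤ
  p∤γ-1 L γ-1≋0 = p∤-1 (≋-trans (≋-reflexive (lemma (γ-at L))) (sub-cong γ-1≋0 (γ≋0[p] L)))
    where lemma : ∀ G → -1ℤ ≡ G + -1ℤ - G
          lemma = solve-∀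

  partialSum-stable : ∀ b n N → n ℕ.≤ N → partialSum p (proj₁ γ) b N n ≡ partialSum p (proj₁ γ) b n n
  partialSum-stable b n N n≤N = residue-unique (partialSum< (proj₁ γ) b N n) (partialSum< (proj₁ γ) b n n) (begin
    + partialSum p (proj₁ γ) b N n            ≈⟨ partialSum≋ (proj₁ γ) b N n ⟩
    cantorSum (γ-at n) b N                    ≡⟨ cong (cantorSum (γ-at n) b) (ℕP.m+[n∸m]≡n n≤N) ⟨
    cantorSum (γ-at n) b (n ℕ.+ (N ℕ.∸ n))    ≈⟨ cantorSum-stable b (γ≋0[p] n) n (N ℕ.∸ n) ⟩
    cantorSum (γ-at n) b n                    ≈⟨ partialSum≋ (proj₁ γ) b n n ⟨
    + partialSum p (proj₁ γ) b n n            ∎)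
    where open ≋-Reasoning n

  partialSum-coherent : ∀ b N n → modP p n (partialSum p (proj₁ γ) b N (suc n)) ≡ partialSum p (proj₁ γ) b N n
  partialSum-coherent b N n = residue-unique (modP< n _) (partialSum< (proj₁ γ) b N n) (begin
    + modP p n (partialSum p (proj₁ γ) b N (suc n))  ≈⟨ modP≋ n _ ⟩
    + partialSum p (proj₁ γ) b N (suc n)             ≈⟨ ≋-weaken-≤ (ℕP.n≤1+n n) (partialSum≋ (proj₁ γ) b N (suc n)) ⟩
    cantorSum (γ-at (suc n)) b N                     ≈⟨ cantorSum-cong b N (residue-coherent γ (ℕP.n≤1+n n)) ⟩
    cantorSum (γ-at n) b N                           ≈⟨ partialSum≋ (proj₁ γ) b N n ⟨
    + partialSum p (proj₁ γ) b N n                   ∎)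
    where open ≋-Reasoning n

  cantorPoint : (ℕ → Bool) → Zp p
  cantorPoint b = (λ n → partialSum p (proj₁ γ) b n n) , (λ n → partialSum< (proj₁ γ) b n n) ,
    λ n → trans (partialSum-coherent b (suc n) n) (partialSum-stable b n (suc n) (ℕP.n≤1+n n))

  cantorPoint-∈ : ∀ b → InCantor p (proj₁ γ) (proj₁ (cantorPoint b))
  cantorPoint-∈ b = b , λ n → n , λ N n≤N → sym (partialSum-stable b n N n≤N)

  m′ : ℕ
  m′ = ℕDv._∣_.quotient (proj₁ v[m]≡e)

  m≡m′*p^e : m ≡ m′ ℕ.* p ℕ.^ e
  m≡m′*p^e = ℕDv._∣_.equality (proj₁ v[m]≡e)

  p∤m′ : p∤ + m′
  p∤m′ m′≋0 with ≋0⇒p∣ m′≋0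
  ... | ℕDv.divides t m′≡t*p = proj₂ v[m]≡e
    (ℕDv.divides t (trans m≡m′*p^e (trans (cong (ℕ._* p ℕ.^ e) m′≡t*p) (ℕP.*-assoc t p (p ℕ.^ e)))))

  linear-m : LinearPower m e
  linear-m with m′ | m≡m′*p^e
  ... | zero     | m≡0 = ⊥-elim (ℕP.≤⇒≯ 2≤m (subst (ℕ._< 2) (sym m≡0) (s≤s z≤n)))
  ... | suc m′-1 | m≡ = subst (λ a → LinearPower a e) (sym m≡)
    (linearPower-* (linearPower-suc m′-1) (linearPower-p^ linear-p e) (s≤s z≤n) (ℕP.m^n>0 p e))
    where
      linear-p : LinearPower p 1
      linear-p with odd-prime p-prime 3≤p
      ... | h , p≡2h+1 , 1≤h = linearPower-odd h p≡2h+1 1≤h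

  σ σ′ : ℤ
  σ  = -1ℤ ^ m
  σ′ = -1ℤ ^ (m ℕ.∸ 1)

  σ*σ≡1 : σ * σ ≡ 1ℤ
  σ*σ≡1 = square (m)
    where square : ∀ n → -1ℤ ^ n * -1ℤ ^ n ≡ 1ℤ
          square zero    = refl
          square (suc n) = trans (lemma (-1ℤ ^ n)) (square n)
            where lemma : ∀ a → -1ℤ * a * (-1ℤ * a) ≡ a * a
                  lemma = solve-∀

  0^m≡0 : 0ℤ ^ m ≡ 0ℤ
  0^m≡0 = trans (cong (0ℤ ^_) (sym (ℕP.m+[n∸m]≡n (ℕP.≤-trans (s≤s z≤n) 2≤m)))) (ℤP.*-zeroˡ (0ℤ ^ (m ℕ.∸ 1)))

  unperturbed : ∀ {n} P D → (P + 0ℤ) ^ m ≋ P ^ m + 0ℤ * D [p^ n ]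
  unperturbed P D = ≋-reflexive (trans (cong (_^ m) (ℤP.+-identityʳ P))
    (sym (trans (cong (λ z → P ^ m + z) (ℤP.*-zeroˡ D)) (ℤP.+-identityʳ _))))

  pow-perturb : ∀ {P δ s} → d ℕ.≤ s → P ≋ -1ℤ [p^ d ] → δ ≋ 0ℤ [p^ s ] →
                (P + δ) ^ m ≋ P ^ m + σ′ * (+ m * δ) [p^ e ℕ.+ (d ℕ.+ s) ]
  pow-perturb {P} {δ} {s} d≤s P≋-1 δ≋0 = begin
    (P + δ) ^ m                                     ≈⟨ ≋-weaken-≤ (ℕP.+-monoʳ-≤ e (ℕP.+-monoˡ-≤ s d≤s)) linear ⟩
    P ^ m + + m * P ^ (m ℕ.∸ 1) * (P + δ - P)       ≡⟨ cong (λ z → P ^ m + z) (lemma (+ m) (P ^ (m ℕ.∸ 1)) P δ) ⟩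
    P ^ m + P ^ (m ℕ.∸ 1) * (+ m * δ)               ≈⟨ +-cong (≋-refl {P ^ m}) (≋-cast (lemmaℕ e d s) slope) ⟩
    P ^ m + σ′ * (+ m * δ)                          ∎
    where
      open ≋-Reasoning (e ℕ.+ (d ℕ.+ s))
      P+δ≋P : P + δ ≋ P [p^ s ]
      P+δ≋P = +-≋0ʳ P δ≋0
      linear = proj₂ linear-m (P + δ) P s (ℕP.≤-trans 1≤d d≤s) P+δ≋P
      slope : P ^ (m ℕ.∸ 1) * (+ m * δ) ≋ σ′ * (+ m * δ) [p^ d ℕ.+ (e ℕ.+ s) ]
      slope = *-congʳ-≋0 (^-cong (m ℕ.∸ 1) P≋-1) (*-≋0 (proj₁ linear-m) δ≋0)
      lemma : ∀ M Q P δ → M * Q * (P + δ - P) ≡ Q * (M * δ)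
      lemma = solve-∀
      lemmaℕ : ∀ e d s → d ℕ.+ (e ℕ.+ s) ≡ e ℕ.+ (d ℕ.+ s)
      lemmaℕ = ℕS.solve-∀

  correction : ℕ → ℤ → ℤ
  correction J G = σ′ * (+ m * ((G + -1ℤ) * G ^ suc J))

  correction-factor : ∀ {L} J → suc d ℕ.≤ L → ∃ λ w → p∤ w × correction J (γ-at L) ≡ w * p^ (e ℕ.+ suc J ℕ.* d)
  correction-factor {L} J d<L = w , p∤w , (begin
    σ′ * (+ m * ((G + -1ℤ) * G ^ suc J))
      ≡⟨ cong (λ z → σ′ * (+ m * ((G + -1ℤ) * z))) (trans (cong (_^ suc J) G≡g*p^d) (^-distribʳ-* g (p^ d) (suc J))) ⟩
    σ′ * (+ m * ((G + -1ℤ) * (g ^ suc J * (p^ d) ^ suc J)))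
      ≡⟨ cong₂ (λ u v → σ′ * (u * ((G + -1ℤ) * (g ^ suc J * v)))) m≡m′*p^e-ℤ (p^-^ d (suc J)) ⟩
    σ′ * (+ m′ * p^ e * ((G + -1ℤ) * (g ^ suc J * p^ (suc J ℕ.* d))))
      ≡⟨ lemma σ′ (+ m′) (p^ e) (G + -1ℤ) (g ^ suc J) (p^ (suc J ℕ.* d)) ⟩
    w * (p^ e * p^ (suc J ℕ.* d))
      ≡⟨ cong (w *_) (p^-+ e (suc J ℕ.* d)) ⟨
    w * p^ (e ℕ.+ suc J ℕ.* d) ∎)
    where
      open ≡-Reasoning
      G = γ-at L
      g = proj₁ (γ-unit-part d<L)
      p∤g = proj₁ (proj₂ (γ-unit-part d<L))
      G≡g*p^d = proj₂ (proj₂ (γ-unit-part d<L))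
      w = σ′ * + m′ * (G + -1ℤ) * g ^ suc J
      m≡m′*p^e-ℤ : + m ≡ + m′ * p^ e
      m≡m′*p^e-ℤ = trans (cong +_ m≡m′*p^e) (ℤP.pos-* m′ (p ℕ.^ e))
      p∤w : p∤ w
      p∤w = p∤-* (p∤-* (p∤-* (p∤-^ (m ℕ.∸ 1) p∤-1) p∤m′) (p∤γ-1 L)) (p∤-^ (suc J) p∤g)
      lemma : ∀ s a E c h S → s * (a * E * (c * (h * S))) ≡ s * a * c * h * (E * S)
      lemma = solve-∀

  pow-near-minus-one : ∀ {G} → G ≋ 0ℤ [p^ d ] → (G + -1ℤ) ^ m ≋ σ [p^ e ℕ.+ d ]
  pow-near-minus-one {G} G≋0 = ≋-trans (≋-reflexive (cong (_^ m) (ℤP.+-comm G -1ℤ)))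
    (≋-trans (≋-weaken-≤ (ℕP.+-monoʳ-≤ e (ℕP.m≤m+n d d)) (pow-perturb ℕP.≤-refl ≋-refl G≋0))
             (+-≋0ʳ σ (≋0-*ˡ σ′ (*-≋0 (proj₁ linear-m) G≋0))))

  pow-perturb-if : ∀ {P δ s} (b₁ b₂ : Bool) → d ℕ.≤ s → (b₁ ≡ true → P ≋ -1ℤ [p^ d ]) → δ ≋ 0ℤ [p^ s ] →
    (P + (if b₁ ∧ not b₂ then δ else 0ℤ)) ^ m
      ≋ P ^ m + (if b₁ ∧ not b₂ then 1ℤ else 0ℤ) * (σ′ * (+ m * δ)) [p^ e ℕ.+ (d ℕ.+ s) ]
  pow-perturb-if {P} {δ} true  false d≤s P≋-1 δ≋0 =
    ≋-trans (pow-perturb d≤s (P≋-1 refl) δ≋0) (≋-reflexive (cong (λ z → P ^ m + z) (sym (ℤP.*-identityˡ _))))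
  pow-perturb-if {P} {δ} true  true  _ _ _ = unperturbed P (σ′ * (+ m * δ))
  pow-perturb-if {P} {δ} false _     _ _ _ = unperturbed P (σ′ * (+ m * δ))

  Q k : ℕ
  Q = p ℕ.^ d
  k = Q ℕ.* (p ℕ.^ e ℕ.+ 1) ℕ.∸ 2

  1≤k : 1 ℕ.≤ k
  1≤k = ℕP.≤-trans (ℕP.∸-monoˡ-≤ 2 2<p^d)
          (ℕP.∸-monoˡ-≤ 2 (ℕP.m≤m*n Q (p ℕ.^ e ℕ.+ 1) {{ℕ.>-nonZero (ℕP.m≤n+m 1 (p ℕ.^ e))}}))

  -- the precision reached after J + 1 digits have been fixed
  L : ℕ → ℕ
  L J = e ℕ.+ suc J ℕ.* d

  module Representation (x : Zp p) where

    X : ℕ → ℤ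
    X n = + proj₁ x n

    first-digits : ∃ λ r → r ℕ.< p ℕ.^ L 0 × X (L 0) ≋ σ * + (Q ℕ.∸ 1 ℕ.+ r) [p^ L 0 ]
    first-digits = r , ℤD.n%ℕd<d a (p ℕ.^ L 0) {{nz}} , ≋-sym (≋-trans
      (≋-reflexive (cong (σ *_) (ℤP.pos-+ (Q ℕ.∸ 1) r)))
      (≋-trans (*-congˡ σ (+-cong (≋-refl {+ (Q ℕ.∸ 1)}) r≋a))
        (≋-reflexive (trans (lemma σ (X (L 0)) (+ (Q ℕ.∸ 1))) (trans (cong (_* X (L 0)) σ*σ≡1) (ℤP.*-identityˡ _))))))
      where
        nz = ℕP.m^n≢0 p (L 0)
        a = σ * X (L 0) - + (Q ℕ.∸ 1)
        r = ℤD._%ℕ_ a (p ℕ.^ L 0) {{nz}}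
        r≋a : + r ≋ a [p^ L 0 ]
        r≋a = ≋-sym (≋-intro (ℤD._/ℕ_ a (p ℕ.^ L 0) {{nz}}) (ℤD.a≡a%ℕn+[a/ℕn]*n a (p ℕ.^ L 0) {{nz}}))
        lemma : ∀ s X c → s * (c + (s * X - c)) ≡ s * s * X
        lemma = solve-∀

    R : ℕ
    R = Q ℕ.∸ 1 ℕ.+ proj₁ first-digits

    Q∸1≤R : Q ℕ.∸ 1 ℕ.≤ R
    Q∸1≤R = ℕP.m≤m+n (Q ℕ.∸ 1) _

    R≤k : R ℕ.≤ k
    R≤k = count-bound Q (p ℕ.^ e) _ (ℕP.m^n>0 p d)
      (subst (proj₁ first-digits ℕ.<_) (trans (cong (p ℕ.^_) (cong (e ℕ.+_) (ℕP.+-identityʳ d))) (ℕP.^-distribˡ-+-* p e d))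
        (proj₁ (proj₂ first-digits)))

    digits : (ℕ → ℕ) → ℕ → ℕ → Bool
    digits φ i zero    = i <ᵇ R
    digits φ i (suc j) = i ∈[ φ (suc j) , R ⟩

    sumOfPowers : (ℕ → ℕ) → ℤ → ℕ → ℤ
    sumOfPowers φ G N = sumTo k (λ i → cantorSum G (digits φ i) N ^ m)

    sumOfPowers-cong : ∀ {G G′ n} φ N → G ≋ G′ [p^ n ] → sumOfPowers φ G N ≋ sumOfPowers φ G′ N [p^ n ]
    sumOfPowers-cong φ N G≋G′ = sumTo-cong k (λ i → ^-cong m (cantorSum-cong (digits φ i) N G≋G′))

    Approximates : ℕ → (ℕ → ℕ) → Set
    Approximates J φ = X (L J) ≋ sumOfPowers φ (γ-at (L J)) (suc J) [p^ L J ]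

    approximates-0 : Approximates 0 (λ _ → 0)
    approximates-0 = begin
      X (L 0)                                                  ≈⟨ proj₂ (proj₂ first-digits) ⟩
      σ * + R                                                  ≡⟨ count ⟨
      sumTo k (λ i → (if i ∈[ 0 , R ⟩ then 1ℤ else 0ℤ) * σ)   ≈⟨ sumTo-cong k (λ i → ≋-sym (digit₀ i (i <ᵇ R))) ⟩
      sumOfPowers (λ _ → 0) G 1                                ∎
      where
        open ≋-Reasoning (L 0)
        G = γ-at (L 0)
        count : sumTo k (λ i → (if i ∈[ 0 , R ⟩ then 1ℤ else 0ℤ) * σ) ≡ σ * + R
        count = trans (sumTo-*ʳ k _ σ) (trans (cong (_* σ) (sumTo-interval k R 0 z≤n R≤k)) (lemma (+ R) σ))
          where lemma : ∀ R σ → (R - 0ℤ) * σ ≡ σ * R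
                lemma = solve-∀
        unit : (G + -1ℤ) ^ m ≋ σ [p^ L 0 ]
        unit = ≋-cast (cong (e ℕ.+_) (sym (ℕP.+-identityʳ d)))
                 (pow-near-minus-one (γ≋0[p^d] (ℕP.≤-trans (ℕP.m≤m+n d 0) (ℕP.m≤n+m _ e))))
        digit₀ : ∀ i b → (0ℤ + (if b then (G + -1ℤ) * 1ℤ else 0ℤ)) ^ m
                         ≋ (if b ∧ not (i <ᵇ 0) then 1ℤ else 0ℤ) * σ [p^ L 0 ]
        digit₀ i true  = ≋-trans (≋-reflexive (cong (_^ m) (lemma G))) (≋-trans unit (≋-reflexive (sym (ℤP.*-identityˡ σ))))
          where lemma : ∀ G → 0ℤ + (G + -1ℤ) * 1ℤ ≡ G + -1ℤ
                lemma = solve-∀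
        digit₀ i false = ≋-reflexive (trans 0^m≡0 (sym (ℤP.*-zeroˡ σ)))

    digits-update : ∀ φ J f i j → j ℕ.≤ J → digits (update φ (suc J) f) i j ≡ digits φ i j
    digits-update φ J f i zero    _   = refl
    digits-update φ J f i (suc j) j≤J =
      cong (λ t → i ∈[ t , R ⟩) (update-other φ (suc J) f (suc j) (λ j≡J → ℕP.<-irrefl j≡J (s≤s j≤J)))

    sumOfPowers-update : ∀ {G} J φ f → G ≋ 0ℤ [p^ d ] → f ℕ.≤ R →
      sumOfPowers (update φ (suc J) f) G (suc (suc J))
        ≋ sumOfPowers φ G (suc J) + (+ R - + f) * correction J G [p^ L (suc J) ]
    sumOfPowers-update {G} J φ f G≋0 f≤R = begin
      sumOfPowers (update φ (suc J) f) G (suc (suc J))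
        ≈⟨ sumTo-cong k summand≋ ⟩
      sumTo k (λ i → P i ^ m + (if i ∈[ f , R ⟩ then 1ℤ else 0ℤ) * correction J G)
        ≡⟨ sumTo-linear k (λ i → P i ^ m) _ (correction J G) ⟩
      sumOfPowers φ G (suc J) + sumTo k (λ i → if i ∈[ f , R ⟩ then 1ℤ else 0ℤ) * correction J G
        ≡⟨ cong (λ z → sumOfPowers φ G (suc J) + z * correction J G) (sumTo-interval k R f f≤R R≤k) ⟩
      sumOfPowers φ G (suc J) + (+ R - + f) * correction J G ∎
      where
        open ≋-Reasoning (L (suc J))
        φ′ = update φ (suc J) f
        δ = (G + -1ℤ) * G ^ suc J
        P : ℕ → ℤ
        P i = cantorSum G (digits φ i) (suc J)
        new-sum : ∀ i → cantorSum G (digits φ′ i) (suc (suc J)) ≡ P i + (if i ∈[ f , R ⟩ then δ else 0ℤ)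
        new-sum i = cong₂ _+_
          (cantorSum-ext G (suc J) (λ j j<J → digits-update φ J f i j (ℕP.≤-pred j<J)))
          (cong (λ t → if i ∈[ t , R ⟩ then δ else 0ℤ) (update-same φ (suc J) f))
        P≋-1 : ∀ i → (i <ᵇ R) ≡ true → P i ≋ -1ℤ [p^ d ]
        P≋-1 i i<R = cantorSum-≋-1 (digits φ i) J i<R G≋0
        summand≋ : ∀ i → cantorSum G (digits φ′ i) (suc (suc J)) ^ m
                         ≋ P i ^ m + (if i ∈[ f , R ⟩ then 1ℤ else 0ℤ) * correction J G [p^ L (suc J) ]
        summand≋ i = ≋-trans (≋-reflexive (cong (_^ m) (new-sum i)))
          (pow-perturb-if (i <ᵇ R) (i <ᵇ f) (ℕP.m≤m+n d (J ℕ.* d)) (P≋-1 i) (≋0-*ˡ (G + -1ℤ) (^-≋0 J G≋0)))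

    approximates-suc : ∀ J φ → Approximates J φ → ∃ λ f → Approximates (suc J) (update φ (suc J) f)
    approximates-suc J φ approx = f , (begin
      X L′                                     ≡⟨ lemma (X L′) SJ ⟩
      SJ + (X L′ - SJ)                         ≡⟨ cong (λ z → SJ + z) t≡ ⟩
      SJ + t * p^ L J                          ≈⟨ +-cong (≋-refl {SJ}) t*p^L≋ ⟩
      SJ + (+ R - + f) * w * p^ L J            ≡⟨ cong (λ z → SJ + z) (trans (ℤP.*-assoc (+ R - + f) w (p^ L J))
                                                                            (cong ((+ R - + f) *_) (sym D≡w*p^L))) ⟩
      SJ + (+ R - + f) * correction J G        ≈⟨ sumOfPowers-update J φ f G≋0 f≤R ⟨
      sumOfPowers (update φ (suc J) f) G (suc (suc J)) ∎)
      where
        open ≋-Reasoning (L (suc J))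
        L′ = L (suc J)
        G = γ-at L′
        SJ = sumOfPowers φ G (suc J)
        L≤L′ : L J ℕ.≤ L′
        L≤L′ = ℕP.+-monoʳ-≤ e (ℕP.m≤n+m (suc J ℕ.* d) d)
        d<L′ : suc d ℕ.≤ L′
        d<L′ = ℕP.≤-trans (ℕP.≤-reflexive (ℕP.+-comm 1 d))
                 (ℕP.≤-trans (ℕP.+-monoʳ-≤ d (ℕP.≤-trans 1≤d (ℕP.m≤m+n d (J ℕ.* d)))) (ℕP.m≤n+m _ e))
        G≋0 : G ≋ 0ℤ [p^ d ]
        G≋0 = γ≋0[p^d] (ℕP.≤-trans (ℕP.n≤1+n d) d<L′)
        X≋SJ : X L′ ≋ SJ [p^ L J ]
        X≋SJ = ≋-trans (residue-coherent x L≤L′)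
                 (≋-trans approx (sumOfPowers-cong φ (suc J) (≋-sym (residue-coherent γ L≤L′))))
        t = proj₁ (≋0-elim (≋⇒-≋0 X≋SJ))
        t≡ = proj₂ (≋0-elim (≋⇒-≋0 X≋SJ))
        w = proj₁ (correction-factor J d<L′)
        p∤w = proj₁ (proj₂ (correction-factor J d<L′))
        D≡w*p^L = proj₂ (proj₂ (correction-factor J d<L′))
        f = proj₁ (solve-≋-below d p∤w R t Q∸1≤R)
        f≤R = proj₁ (proj₂ (solve-≋-below d p∤w R t Q∸1≤R))
        [R-f]w≋t = proj₂ (proj₂ (solve-≋-below d p∤w R t Q∸1≤R))
        lemma : ∀ X S → X ≡ S + (X - S)
        lemma = solve-∀
        lemmaℕ : ∀ e d J → d ℕ.+ (e ℕ.+ suc J ℕ.* d) ≡ e ℕ.+ suc (suc J) ℕ.* d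
        lemmaℕ = ℕS.solve-∀
        t*p^L≋ : t * p^ L J ≋ (+ R - + f) * w * p^ L J [p^ L′ ]
        t*p^L≋ = ≋-cast (lemmaℕ e d J) (*-congʳ-≋0 (≋-sym [R-f]w≋t) (p^-≋0 (L J)))

    stage : ∀ J → ∃ (Approximates J)
    stage zero    = (λ _ → 0) , approximates-0
    stage (suc J) = update (proj₁ (stage J)) (suc J) (proj₁ next) , proj₂ next
      where next = approximates-suc J (proj₁ (stage J)) (proj₂ (stage J))

    threshold : ℕ → ℕ
    threshold u = proj₁ (stage u) u

    stage-stable : ∀ J u → u ℕ.≤ J → proj₁ (stage J) u ≡ threshold u
    stage-stable zero    zero    _   = refl
    stage-stable (suc J) u       u≤J = by-cases (u ℕ.≟ suc J)
      where
        by-cases : Dec (u ≡ suc J) → proj₁ (stage (suc J)) u ≡ threshold u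
        by-cases (yes refl) = refl
        by-cases (no u≢J)   = trans (update-other (proj₁ (stage J)) (suc J) _ u u≢J)
                                    (stage-stable J u (ℕP.≤-pred (ℕP.≤∧≢⇒< u≤J u≢J)))

    summand : ℕ → Zp p
    summand i = cantorPoint (digits threshold i)

    sum-of-summands : ∀ n → proj₁ x n ≡ sumPow p k (λ i → proj₁ (summand (toℕ i))) m n
    sum-of-summands n = residue-unique (proj₁ (proj₂ x) n) (sumPow< k _ m n) (begin
      X n                                                 ≈⟨ residue-coherent x n≤L ⟨
      X (L n)                                             ≈⟨ ≋-weaken-≤ n≤L (proj₂ (stage n)) ⟩
      sumOfPowers (proj₁ (stage n)) (γ-at (L n)) (suc n)  ≈⟨ sumOfPowers-cong _ (suc n) (residue-coherent γ n≤L) ⟩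
      sumOfPowers (proj₁ (stage n)) (γ-at n) (suc n)      ≡⟨ sumTo-ext k (λ i → cong (_^ m) (same-digits i)) ⟩
      sumOfPowers threshold (γ-at n) (suc n)              ≈⟨ sumTo-cong k (λ i → ^-cong m (drop-last i)) ⟩
      sumTo k (λ i → cantorSum (γ-at n) (b i) n ^ m)
        ≈⟨ sumTo-cong k (λ i → ^-cong m (partialSum≋ (proj₁ γ) (b i) n n)) ⟨
      sumTo k (λ i → (+ proj₁ (summand i) n) ^ m)         ≈⟨ sumPow≋ k (λ i → proj₁ (summand i)) m n ⟨
      + sumPow p k (λ i → proj₁ (summand (toℕ i))) m n    ∎)
      where
        open ≋-Reasoning n
        b = digits threshold
        digits-stable : ∀ i j → j ℕ.≤ n → digits (proj₁ (stage n)) i j ≡ digits threshold i j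
        digits-stable i zero    _   = refl
        digits-stable i (suc j) j≤n = cong (λ t → i ∈[ t , R ⟩) (stage-stable n (suc j) j≤n)
        same-digits : ∀ i → cantorSum (γ-at n) (digits (proj₁ (stage n)) i) (suc n)
                            ≡ cantorSum (γ-at n) (b i) (suc n)
        same-digits i = cantorSum-ext (γ-at n) (suc n) (λ j j<n → digits-stable i j (ℕP.≤-pred j<n))
        drop-last : ∀ i → cantorSum (γ-at n) (b i) (suc n) ≋ cantorSum (γ-at n) (b i) n [p^ n ]
        drop-last i = ≋-trans (≋-reflexive (cong (cantorSum (γ-at n) (b i)) (ℕP.+-comm 1 n)))
                              (cantorSum-stable (b i) (γ≋0[p] n) n 1)
        n≤L : n ℕ.≤ L n
        n≤L = ℕP.≤-trans (ℕP.n≤1+n n) (ℕP.≤-trans (ℕP.m≤m*n (suc n) d {{ℕ.>-nonZero 1≤d}}) (ℕP.m≤n+m _ e))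

open import Data.Nat using (_+_; _*_; _∸_; _^_; _≤_; _<_)

theorem7p3 : (p : ℕ) .{{_ : NonZero p}} → Prime p → 3 ≤ p →
    (γ : Zp p) → proj₁ γ 1 ≡ 0 →
    (d : ℕ) → ValZp p (proj₁ γ) d → 2 < p ^ d →
    (m : ℕ) → 2 ≤ m → (e : ℕ) → ValNat p m e →
    ∃ λ (k : ℕ) → (1 ≤ k) × (k ≤ p ^ d * (p ^ e + 1) ∸ 2) ×
      ((x : Zp p) → ∃ λ (xs : Fin k → Zp p) →
        (∀ i → InCantor p (proj₁ γ) (proj₁ (xs i))) ×
        (∀ n → proj₁ x n ≡ sumPow p k (λ i → proj₁ (xs i)) m n))
theorem7p3 p p-prime 3≤p γ γ₁≡0 d v[γ]≡d 2<p^d m 2≤m e v[m]≡e =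
  k , 1≤k , ℕP.≤-refl , λ x →
    let open Representation x in
    (λ i → summand (toℕ i)) , (λ i → cantorPoint-∈ (digits threshold (toℕ i))) , sum-of-summands
  where open Construction p p-prime 3≤p γ γ₁≡0 d v[γ]≡d 2<p^d m 2≤m e v[m]≡e
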